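{- Let $S$ be a first-order theory with identity satisfying the standing assumptions described in the context, and let $\Theta$ be the sentence $$\forall x\,\exists y\,\mathrm{H}(x,y),$$ where $\mathrm{H}(x,y)$ is a quantifier-free formula of $S$ expressing the primitive recursive relation: "if $x$ is the Gödel number of an $S$-proof of a sentence of the form $\forall u\,\exists v\,A(u,v)$ with $A$ quantifier-free, then $y$ is the Gödel number of an $S$-proof of the sentence $A(\overline{x},\overline{n})$ for some natural number $n$". If $S$ is $1$-consistent, then $\Theta$ is not provable in $S$.
   Context: Language and axioms of $S$: the language contains the constant $0$, the successor symbol, and a function symbol for every primitive recursive function. The axioms include the defining recursion equations of these functions. The set of axioms is primitive recursive, so the proof relation of $S$ is primitive recursive. Numerals and predicates: $\overline{n}=0^{(n)}$ denotes the numeral for $n$ (successor applied $n$ times to $0$). A primitive recursive predicate is represented by a formula $f(\vec x)=1$ with $f$ a primitive recursive function symbol. Every true closed quantifier-free sentence of $S$ is provable in $S$. Gödel numbering: a fixed standard Gödel numbering of formulas and proofs is used. In it, the Gödel number of a proof of a formula containing the numeral $\overline{n}$ exceeds $n$. $\Pi^0_2$ sentences: a $\Pi^0_2$ sentence here means one of the form $\forall u\,\exists v\,A(u,v)$ with $A$ quantifier-free. Consistency notions: $S$ is $1$-consistent ($\Sigma^0_1$-correct) if every $\Sigma^0_1$ sentence, i.e. every $\exists y\,B(y)$ with $B$ quantifier-free, that is provable in $S$ is true in the standard natural numbers. -}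

module Defs where

open import Data.Nat using (ℕ; zero; suc; _+_; _*_; _^_)
open import Data.Fin using (Fin; toℕ) renaming (zero to fz; suc to fs)
open import Data.Vec using (Vec; []; _∷_; tabulate; map)
open import Data.Product using (Σ; _×_; _,_)
open import Data.Empty using (⊥)
open import Relation.Binary.PropositionalEquality using (_≡_)
open import Relation.Nullary using (¬_)
open import Function.Bundles using (_⇔_)

data PR : ℕ → Set where
  Zᵖ : PR 0
  Sᵖ : PR 1
  Pᵖ : ∀ {n} → Fin n → PR n
  Cᵖ : ∀ {m n} → PR m → Vec (PR n) m → PR n
  Rᵖ : ∀ {n} → PR n → PR (suc (suc n)) → PR (suc n)

lookupV : ∀ {n} → Vec ℕ n → Fin n → ℕ
lookupV (x ∷ xs) fz = x
lookupV (x ∷ xs) (fs i) = lookupV xs i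

mutual
  evalPR : ∀ {n} → PR n → Vec ℕ n → ℕ
  evalPR Zᵖ xs = 0
  evalPR Sᵖ (x ∷ []) = suc x
  evalPR (Pᵖ i) xs = lookupV xs i
  evalPR (Cᵖ f gs) xs = evalPR f (evalPRs gs xs)
  evalPR (Rᵖ g h) (x ∷ xs) = evalRec g h x xs

  evalPRs : ∀ {m n} → Vec (PR n) m → Vec ℕ n → Vec ℕ m
  evalPRs [] xs = []
  evalPRs (g ∷ gs) xs = evalPR g xs ∷ evalPRs gs xs

  evalRec : ∀ {n} → PR n → PR (suc (suc n)) → ℕ → Vec ℕ n → ℕ
  evalRec g h zero xs = evalPR g xs
  evalRec g h (suc x) xs = evalPR h (x ∷ evalRec g h x xs ∷ xs)

data Term (n : ℕ) : Set where
  var : Fin n → Term n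
  𝟎   : Term n
  𝐒   : Term n → Term n
  fn  : ∀ {k} → PR k → Vec (Term n) k → Term n

infix  7 _≐_
infixr 5 _⇒_

data Fm (n : ℕ) : Set where
  _≐_ : Term n → Term n → Fm n
  ⊥'  : Fm n
  _⇒_ : Fm n → Fm n → Fm n
  ∀'  : Fm (suc n) → Fm n

¬' : ∀ {n} → Fm n → Fm n
¬' φ = φ ⇒ ⊥'

∃' : ∀ {n} → Fm (suc n) → Fm n
∃' φ = ¬' (∀' (¬' φ))

Sentence : Set
Sentence = Fm 0

data QF {n : ℕ} : Fm n → Set where
  qf-≐ : ∀ {s t} → QF (s ≐ t)
  qf-⊥ : QF ⊥'
  qf-⇒ : ∀ {φ ψ} → QF φ → QF ψ → QF (φ ⇒ ψ)

num : ∀ {n} → ℕ → Term n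
num zero = 𝟎
num (suc k) = 𝐒 (num k)

mutual
  renT : ∀ {n m} → (Fin n → Fin m) → Term n → Term m
  renT r (var i) = var (r i)
  renT r 𝟎 = 𝟎
  renT r (𝐒 t) = 𝐒 (renT r t)
  renT r (fn f ts) = fn f (renTs r ts)

  renTs : ∀ {n m k} → (Fin n → Fin m) → Vec (Term n) k → Vec (Term m) k
  renTs r [] = []
  renTs r (t ∷ ts) = renT r t ∷ renTs r ts

liftR : ∀ {n m} → (Fin n → Fin m) → Fin (suc n) → Fin (suc m)
liftR r fz = fz
liftR r (fs i) = fs (r i)

renF : ∀ {n m} → (Fin n → Fin m) → Fm n → Fm m
renF r (s ≐ t) = renT r s ≐ renT r t
renF r ⊥' = ⊥'
renF r (φ ⇒ ψ) = renF r φ ⇒ renF r ψ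
renF r (∀' φ) = ∀' (renF (liftR r) φ)

mutual
  subT : ∀ {n m} → (Fin n → Term m) → Term n → Term m
  subT σ (var i) = σ i
  subT σ 𝟎 = 𝟎
  subT σ (𝐒 t) = 𝐒 (subT σ t)
  subT σ (fn f ts) = fn f (subTs σ ts)

  subTs : ∀ {n m k} → (Fin n → Term m) → Vec (Term n) k → Vec (Term m) k
  subTs σ [] = []
  subTs σ (t ∷ ts) = subT σ t ∷ subTs σ ts

liftS : ∀ {n m} → (Fin n → Term m) → Fin (suc n) → Term (suc m)
liftS σ fz = var fz
liftS σ (fs i) = renT fs (σ i)

subF : ∀ {n m} → (Fin n → Term m) → Fm n → Fm m
subF σ (s ≐ t) = subT σ s ≐ subT σ t
subF σ ⊥' = ⊥'
subF σ (φ ⇒ ψ) = subF σ φ ⇒ subF σ ψ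
subF σ (∀' φ) = ∀' (subF (liftS σ) φ)

_[_] : ∀ {n} → Fm (suc n) → Term n → Fm n
φ [ t ] = subF σ φ
  where
  σ : Fin (suc _) → Term _
  σ fz = t
  σ (fs i) = var i

wkF : ∀ {n} → Fm n → Fm (suc n)
wkF = renF fs

fromSentence : ∀ {n} → Sentence → Fm n
fromSentence = renF (λ ())

closeAll : ∀ {n} → Fm n → Sentence
closeAll {zero} φ = φ
closeAll {suc n} φ = closeAll (∀' φ)

-- A(u,v) with u = var 1 (bound by the outer ∀), v = var 0 (bound by ∃).
-- inst2 A a b  is  A(a,b).
inst2 : Fm 2 → Term 0 → Term 0 → Sentence
inst2 A a b = subF σ A
  where
  σ : Fin 2 → Term 0
  σ fz = b
  σ (fs fz) = a

mutual
  ⟦_⟧t : ∀ {n} → Term n → (Fin n → ℕ) → ℕ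
  ⟦ var i ⟧t ρ = ρ i
  ⟦ 𝟎 ⟧t ρ = 0
  ⟦ 𝐒 t ⟧t ρ = suc (⟦ t ⟧t ρ)
  ⟦ fn f ts ⟧t ρ = evalPR f (⟦ ts ⟧ts ρ)

  ⟦_⟧ts : ∀ {n k} → Vec (Term n) k → (Fin n → ℕ) → Vec ℕ k
  ⟦ [] ⟧ts ρ = []
  ⟦ t ∷ ts ⟧ts ρ = ⟦ t ⟧t ρ ∷ ⟦ ts ⟧ts ρ

consEnv : ∀ {n} → ℕ → (Fin n → ℕ) → Fin (suc n) → ℕ
consEnv a ρ fz = a
consEnv a ρ (fs i) = ρ i

⟦_⟧ : ∀ {n} → Fm n → (Fin n → ℕ) → Set
⟦ s ≐ t ⟧ ρ = ⟦ s ⟧t ρ ≡ ⟦ t ⟧t ρ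
⟦ ⊥' ⟧ ρ = ⊥
⟦ φ ⇒ ψ ⟧ ρ = ⟦ φ ⟧ ρ → ⟦ ψ ⟧ ρ
⟦ ∀' φ ⟧ ρ = (a : ℕ) → ⟦ φ ⟧ (consEnv a ρ)

emptyEnv : Fin 0 → ℕ
emptyEnv ()

True : Sentence → Set
True φ = ⟦ φ ⟧ emptyEnv

env2 : ℕ → ℕ → Fin 2 → ℕ
env2 x y fz = y
env2 x y (fs fz) = x

Axioms : Set₁
Axioms = Sentence → Set

infix 3 _⊢_

data _⊢_ (Ax : Axioms) : ∀ {n} → Fm n → Set where
  ax   : ∀ {n} {φ : Sentence} → Ax φ → Ax ⊢ fromSentence {n} φ
  a1   : ∀ {n} (φ ψ : Fm n) → Ax ⊢ φ ⇒ (ψ ⇒ φ)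
  a2   : ∀ {n} (φ ψ χ : Fm n) → Ax ⊢ (φ ⇒ (ψ ⇒ χ)) ⇒ ((φ ⇒ ψ) ⇒ (φ ⇒ χ))
  a3   : ∀ {n} (φ : Fm n) → Ax ⊢ ¬' (¬' φ) ⇒ φ
  mp   : ∀ {n} {φ ψ : Fm n} → Ax ⊢ φ ⇒ ψ → Ax ⊢ φ → Ax ⊢ ψ
  gen  : ∀ {n} {φ : Fm (suc n)} → Ax ⊢ φ → Ax ⊢ ∀' φ
  q1   : ∀ {n} (φ : Fm (suc n)) (t : Term n) → Ax ⊢ ∀' φ ⇒ φ [ t ]
  q2   : ∀ {n} (ψ : Fm n) (φ : Fm (suc n)) → Ax ⊢ ∀' (wkF ψ ⇒ φ) ⇒ (ψ ⇒ ∀' φ)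
  refl' : ∀ {n} (t : Term n) → Ax ⊢ t ≐ t
  leib : ∀ {n} (φ : Fm (suc n)) (s t : Term n) → Ax ⊢ (s ≐ t) ⇒ (φ [ s ] ⇒ φ [ t ])

-- Fixed Gödel numbering.  pair a b = 2^a (2b+1) is a bijection ℕ×ℕ → ℕ∖{0},
-- strictly above both a and b.

pair : ℕ → ℕ → ℕ
pair a b = 2 ^ a * (2 * b + 1)

mutual
  ⌜_⌝pr : ∀ {n} → PR n → ℕ
  ⌜_⌝pr {n} Zᵖ = pair 0 n
  ⌜_⌝pr {n} Sᵖ = pair 1 n
  ⌜_⌝pr {n} (Pᵖ i) = pair 2 (pair n (toℕ i))
  ⌜_⌝pr {n} (Cᵖ {m} f gs) = pair 3 (pair n (pair m (pair ⌜ f ⌝pr ⌜ gs ⌝prs)))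
  ⌜_⌝pr {n} (Rᵖ g h) = pair 4 (pair n (pair ⌜ g ⌝pr ⌜ h ⌝pr))

  ⌜_⌝prs : ∀ {m n} → Vec (PR n) m → ℕ
  ⌜ [] ⌝prs = 0
  ⌜ g ∷ gs ⌝prs = pair ⌜ g ⌝pr ⌜ gs ⌝prs

mutual
  ⌜_⌝t : ∀ {n} → Term n → ℕ
  ⌜ var i ⌝t = pair 0 (toℕ i)
  ⌜ 𝟎 ⌝t = pair 1 0
  ⌜ 𝐒 t ⌝t = pair 2 ⌜ t ⌝t
  ⌜ fn f ts ⌝t = pair 3 (pair ⌜ f ⌝pr ⌜ ts ⌝ts)

  ⌜_⌝ts : ∀ {n k} → Vec (Term n) k → ℕ
  ⌜ [] ⌝ts = 0
  ⌜ t ∷ ts ⌝ts = pair ⌜ t ⌝t ⌜ ts ⌝ts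

⌜_⌝ : ∀ {n} → Fm n → ℕ
⌜ s ≐ t ⌝ = pair 0 (pair ⌜ s ⌝t ⌜ t ⌝t)
⌜ ⊥' ⌝ = pair 1 0
⌜ φ ⇒ ψ ⌝ = pair 2 (pair ⌜ φ ⌝ ⌜ ψ ⌝)
⌜ ∀' φ ⌝ = pair 3 ⌜ φ ⌝

⌜_⌝p : ∀ {Ax n} {φ : Fm n} → Ax ⊢ φ → ℕ
⌜_⌝p {φ = φ} (ax _) = pair ⌜ φ ⌝ (pair 0 0)
⌜_⌝p {φ = φ} (a1 _ _) = pair ⌜ φ ⌝ (pair 1 0)
⌜_⌝p {φ = φ} (a2 _ _ _) = pair ⌜ φ ⌝ (pair 2 0)
⌜_⌝p {φ = φ} (a3 _) = pair ⌜ φ ⌝ (pair 3 0)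
⌜_⌝p {φ = φ} (mp p q) = pair ⌜ φ ⌝ (pair 4 (pair ⌜ p ⌝p ⌜ q ⌝p))
⌜_⌝p {φ = φ} (gen p) = pair ⌜ φ ⌝ (pair 5 ⌜ p ⌝p)
⌜_⌝p {φ = φ} (q1 _ t) = pair ⌜ φ ⌝ (pair 6 ⌜ t ⌝t)
⌜_⌝p {φ = φ} (q2 _ _) = pair ⌜ φ ⌝ (pair 7 0)
⌜_⌝p {φ = φ} (refl' _) = pair ⌜ φ ⌝ (pair 8 0)
⌜_⌝p {φ = φ} (leib ψ _ _) = pair ⌜ φ ⌝ (pair 9 ⌜ ψ ⌝)

vars : ∀ k → Vec (Term k) k
vars k = tabulate var

data DefEq : ∀ {n} → Fm n → Set where
  de-Z : DefEq {0} (fn Zᵖ [] ≐ 𝟎)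
  de-S : DefEq {1} (fn Sᵖ (var fz ∷ []) ≐ 𝐒 (var fz))
  de-P : ∀ {k} (i : Fin k) → DefEq {k} (fn (Pᵖ i) (vars k) ≐ var i)
  de-C : ∀ {m k} (f : PR m) (gs : Vec (PR k) m) →
         DefEq {k} (fn (Cᵖ f gs) (vars k) ≐ fn f (map (λ g → fn g (vars k)) gs))
  de-R0 : ∀ {k} (g : PR k) (h : PR (suc (suc k))) →
          DefEq {k} (fn (Rᵖ g h) (𝟎 ∷ vars k) ≐ fn g (vars k))
  de-R1 : ∀ {k} (g : PR k) (h : PR (suc (suc k))) →
          DefEq {suc k}
            (fn (Rᵖ g h) (𝐒 (var fz) ∷ tabulate (λ i → var (fs i)))
              ≐ fn h (var fz ∷ fn (Rᵖ g h) (var fz ∷ tabulate (λ i → var (fs i)))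
                             ∷ tabulate (λ i → var (fs i))))

IncludesDefEqs : Axioms → Set
IncludesDefEqs Ax = ∀ {n} (φ : Fm n) → DefEq φ → Ax (closeAll φ)

AxiomsPR : Axioms → Set
AxiomsPR Ax = Σ (PR 1) λ χ →
  (m : ℕ) → (evalPR χ (m ∷ []) ≡ 1) ⇔ Σ Sentence (λ φ → Ax φ × ⌜ φ ⌝ ≡ m)

QFComplete : Axioms → Set
QFComplete Ax = (φ : Sentence) → QF φ → True φ → Ax ⊢ φ

OneConsistent : Axioms → Set
OneConsistent Ax = (B : Fm 1) → QF B → Ax ⊢ ∃' B → True (∃' B)

HRel : Axioms → ℕ → ℕ → Set
HRel Ax x y =
  (A : Fm 2) → QF A → (π : Ax ⊢ ∀' (∃' A)) → ⌜ π ⌝p ≡ x →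
  Σ ℕ λ n → Σ (Ax ⊢ inst2 A (num x) (num n)) λ π' → ⌜ π' ⌝p ≡ y

Expresses : Axioms → Fm 2 → Set
Expresses Ax H = (x y : ℕ) → ⟦ H ⟧ (env2 x y) ⇔ HRel Ax x y

Θ : Fm 2 → Sentence
Θ H = ∀' (∃' H)

-- Let π prove Θ and put x = ⌜π⌝. By 1-consistency H(x, y) holds for some y, and any such y is the
-- code of a proof of H(x̄, n̄) for some n; this instance is true since S proves no false closed
-- quantifier-free sentence. Since a proof's code exceeds every numeral written in it, either n < y
-- with H(x, n), or H does not depend on y and H(x, 0) with 0 < y. So the witnesses of H(x, ·) would
-- form an infinite descending sequence of natural numbers.
module Submission where

open import Defs
open import Data.Nat using (ℕ; zero; suc; _^_; _*_; _+_; _<_; z≤n; z<s; _≟_; >-nonZero)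
open import Data.Nat.Properties
  using (<-trans; ≤-<-trans; <-≤-trans; m≤m+n; m≤n+m; m<m+n; +-mono-≤-<; m≤m*n; m≤n*m; m^n≢0; m^n>0)
open import Data.Nat.Induction using (<-wellFounded)
open import Data.Fin using (Fin) renaming (zero to fz; suc to fs)
open import Data.Vec using (Vec; []; _∷_)
open import Data.Product using (_,_)
open import Data.Sum using (_⊎_; inj₁; inj₂)
open import Function.Bundles using (_⇔_; Equivalence)
open import Function.Construct.Identity using (⇔-id)
open import Function.Related.TypeIsomorphisms using (→-cong-⇔)
open import Induction.InfiniteDescent using (Descent; descent∧wf⇒empty)
open import Relation.Nullary using (¬_; Dec; no)
open import Relation.Nullary.Decidable using (_→-dec_; decidable-stable)
open import Relation.Binary.PropositionalEquality using (_≡_; refl; sym; trans; cong; cong₂)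

open Equivalence using (to)

n<2^n : ∀ n → n < 2 ^ n
n<2^n zero = z<s
n<2^n (suc n) = +-mono-≤-< (m^n>0 2 n) (<-≤-trans (n<2^n n) (m≤m+n (2 ^ n) 0))

<pairˡ : ∀ a b → a < pair a b
<pairˡ a b = <-≤-trans (n<2^n a) (m≤m*n (2 ^ a) (2 * b + 1) {{>-nonZero (m≤n+m 1 (2 * b))}})

<pairʳ : ∀ a b → b < pair a b
<pairʳ a b = <-≤-trans (≤-<-trans (m≤m+n b (b + 0)) (m<m+n (2 * b) z<s))
                       (m≤n*m (2 * b + 1) (2 ^ a) {{m^n≢0 2 a}})

⌜⌝<⌜⌝p : ∀ {Ax n} {φ : Fm n} (p : Ax ⊢ φ) → ⌜ φ ⌝ < ⌜ p ⌝p
⌜⌝<⌜⌝p {φ = φ} (ax _)       = <pairˡ ⌜ φ ⌝ (pair 0 0)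
⌜⌝<⌜⌝p {φ = φ} (a1 _ _)     = <pairˡ ⌜ φ ⌝ (pair 1 0)
⌜⌝<⌜⌝p {φ = φ} (a2 _ _ _)   = <pairˡ ⌜ φ ⌝ (pair 2 0)
⌜⌝<⌜⌝p {φ = φ} (a3 _)       = <pairˡ ⌜ φ ⌝ (pair 3 0)
⌜⌝<⌜⌝p {φ = φ} (mp p q)     = <pairˡ ⌜ φ ⌝ (pair 4 (pair ⌜ p ⌝p ⌜ q ⌝p))
⌜⌝<⌜⌝p {φ = φ} (gen p)      = <pairˡ ⌜ φ ⌝ (pair 5 ⌜ p ⌝p)
⌜⌝<⌜⌝p {φ = φ} (q1 _ t)     = <pairˡ ⌜ φ ⌝ (pair 6 ⌜ t ⌝t)
⌜⌝<⌜⌝p {φ = φ} (q2 _ _)     = <pairˡ ⌜ φ ⌝ (pair 7 0)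
⌜⌝<⌜⌝p {φ = φ} (refl' _)    = <pairˡ ⌜ φ ⌝ (pair 8 0)
⌜⌝<⌜⌝p {φ = φ} (leib ψ _ _) = <pairˡ ⌜ φ ⌝ (pair 9 ⌜ ψ ⌝)

n<⌜num⌝ : ∀ {m} n → n < ⌜ num {m} n ⌝t
n<⌜num⌝ zero        = <pairʳ 1 0
n<⌜num⌝ {m} (suc n) = ≤-<-trans (n<⌜num⌝ n) (<pairʳ 2 ⌜ num {m} n ⌝t)

⊥'-elim : ∀ {Ax n} (φ : Fm n) → Ax ⊢ ⊥' → Ax ⊢ φ
⊥'-elim φ ⊢⊥ = mp (a3 φ) (mp (a1 ⊥' (¬' φ)) ⊢⊥)

oneConsistent⇒consistent : ∀ {Ax} → OneConsistent Ax → ¬ (Ax ⊢ ⊥')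
oneConsistent⇒consistent oc ⊢⊥ = oc ⊥' qf-⊥ (⊥'-elim (∃' ⊥') ⊢⊥) (λ _ ⊥-holds → ⊥-holds)

⟦⟧-dec : ∀ {n} {A : Fm n} → QF A → (ρ : Fin n → ℕ) → Dec (⟦ A ⟧ ρ)
⟦⟧-dec (qf-≐ {s} {t}) ρ = ⟦ s ⟧t ρ ≟ ⟦ t ⟧t ρ
⟦⟧-dec qf-⊥ ρ = no (λ ())
⟦⟧-dec (qf-⇒ qA qB) ρ = ⟦⟧-dec qA ρ →-dec ⟦⟧-dec qB ρ

-- A false closed QF sentence is refutable, so proving it would make S inconsistent.
provable-QF⇒true : ∀ {Ax} → QFComplete Ax → OneConsistent Ax →
                   {φ : Sentence} → QF φ → Ax ⊢ φ → True φ
provable-QF⇒true qfc oc {φ} qφ ⊢φ = decidable-stable (⟦⟧-dec qφ emptyEnv) λ φ-false →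
  oneConsistent⇒consistent oc (mp (qfc (¬' φ) (qf-⇒ qφ qf-⊥) φ-false) ⊢φ)

QF-subF : ∀ {n m} {A : Fm n} (σ : Fin n → Term m) → QF A → QF (subF σ A)
QF-subF σ qf-≐         = qf-≐
QF-subF σ qf-⊥         = qf-⊥
QF-subF σ (qf-⇒ qA qB) = qf-⇒ (QF-subF σ qA) (QF-subF σ qB)

mutual
  sem-subT : ∀ {n m} (σ : Fin n → Term m) {ρ : Fin m → ℕ} {ρ' : Fin n → ℕ} →
             (∀ i → ⟦ σ i ⟧t ρ ≡ ρ' i) → (t : Term n) → ⟦ subT σ t ⟧t ρ ≡ ⟦ t ⟧t ρ'
  sem-subT σ σ≗ρ' (var i)   = σ≗ρ' i
  sem-subT σ σ≗ρ' 𝟎         = refl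
  sem-subT σ σ≗ρ' (𝐒 t)     = cong suc (sem-subT σ σ≗ρ' t)
  sem-subT σ σ≗ρ' (fn f ts) = cong (evalPR f) (sem-subTs σ σ≗ρ' ts)

  sem-subTs : ∀ {n m k} (σ : Fin n → Term m) {ρ : Fin m → ℕ} {ρ' : Fin n → ℕ} →
              (∀ i → ⟦ σ i ⟧t ρ ≡ ρ' i) → (ts : Vec (Term n) k) → ⟦ subTs σ ts ⟧ts ρ ≡ ⟦ ts ⟧ts ρ'
  sem-subTs σ σ≗ρ' []       = refl
  sem-subTs σ σ≗ρ' (t ∷ ts) = cong₂ _∷_ (sem-subT σ σ≗ρ' t) (sem-subTs σ σ≗ρ' ts)

sem-subF : ∀ {n m} {A : Fm n} → QF A → (σ : Fin n → Term m) {ρ : Fin m → ℕ} {ρ' : Fin n → ℕ} →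
           (∀ i → ⟦ σ i ⟧t ρ ≡ ρ' i) → ⟦ subF σ A ⟧ ρ ⇔ ⟦ A ⟧ ρ'
sem-subF (qf-≐ {s} {t}) σ σ≗ρ' rewrite sem-subT σ σ≗ρ' s | sem-subT σ σ≗ρ' t = ⇔-id _
sem-subF qf-⊥           σ σ≗ρ' = ⇔-id _
sem-subF (qf-⇒ qA qB)   σ σ≗ρ' = →-cong-⇔ (sem-subF qA σ σ≗ρ') (sem-subF qB σ σ≗ρ')

sem-num : ∀ {n} k (ρ : Fin n → ℕ) → ⟦ num k ⟧t ρ ≡ k
sem-num zero    ρ = refl
sem-num (suc k) ρ = cong suc (sem-num k ρ)

sem-renT-num : ∀ {n m} (r : Fin n → Fin m) k (ρ : Fin m → ℕ) → ⟦ renT r (num k) ⟧t ρ ≡ k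
sem-renT-num r zero    ρ = refl
sem-renT-num r (suc k) ρ = cong suc (sem-renT-num r k ρ)

true-inst2 : ∀ {A : Fm 2} → QF A → ∀ a b → True (inst2 A (num a) (num b)) → ⟦ A ⟧ (env2 a b)
true-inst2 qA a b = to (sem-subF qA _ λ { fz → sem-num b emptyEnv ; (fs fz) → sem-num a emptyEnv })

AgreeOffZero : ∀ {n} → (ρ ρ' : Fin (suc n) → ℕ) → Set
AgreeOffZero ρ ρ' = ∀ i → ρ (fs i) ≡ ρ' (fs i)

IgnoresZero : ∀ {n} → Fm (suc n) → Set
IgnoresZero A = ∀ {ρ ρ'} → AgreeOffZero ρ ρ' → ⟦ A ⟧ ρ → ⟦ A ⟧ ρ'

mutual
  num-occurs-or-ignoredT : ∀ {n m k} {σ : Fin (suc n) → Term m} → σ fz ≡ num k → (t : Term (suc n)) →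
                           k < ⌜ subT σ t ⌝t ⊎ (∀ {ρ ρ'} → AgreeOffZero ρ ρ' → ⟦ t ⟧t ρ ≡ ⟦ t ⟧t ρ')
  num-occurs-or-ignoredT {k = k} σ₀ (var fz) rewrite σ₀ = inj₁ (n<⌜num⌝ k)
  num-occurs-or-ignoredT σ₀ (var (fs i)) = inj₂ λ agree → agree i
  num-occurs-or-ignoredT σ₀ 𝟎 = inj₂ λ _ → refl
  num-occurs-or-ignoredT {σ = σ} σ₀ (𝐒 t) with num-occurs-or-ignoredT σ₀ t
  ... | inj₁ k< = inj₁ (<-trans k< (<pairʳ 2 ⌜ subT σ t ⌝t))
  ... | inj₂ ignored = inj₂ λ agree → cong suc (ignored agree)
  num-occurs-or-ignoredT σ₀ (fn f ts) with num-occurs-or-ignoredTs σ₀ ts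
  ... | inj₁ k< = inj₁ (<-trans (<-trans k< (<pairʳ ⌜ f ⌝pr _)) (<pairʳ 3 _))
  ... | inj₂ ignored = inj₂ λ agree → cong (evalPR f) (ignored agree)

  num-occurs-or-ignoredTs : ∀ {n m k j} {σ : Fin (suc n) → Term m} → σ fz ≡ num k →
                            (ts : Vec (Term (suc n)) j) →
                            k < ⌜ subTs σ ts ⌝ts ⊎ (∀ {ρ ρ'} → AgreeOffZero ρ ρ' → ⟦ ts ⟧ts ρ ≡ ⟦ ts ⟧ts ρ')
  num-occurs-or-ignoredTs σ₀ [] = inj₂ λ _ → refl
  num-occurs-or-ignoredTs {σ = σ} σ₀ (t ∷ ts)
    with num-occurs-or-ignoredT σ₀ t | num-occurs-or-ignoredTs σ₀ ts
  ... | inj₁ k< | _      = inj₁ (<-trans k< (<pairˡ _ ⌜ subTs σ ts ⌝ts))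
  ... | inj₂ _  | inj₁ k< = inj₁ (<-trans k< (<pairʳ ⌜ subT σ t ⌝t _))
  ... | inj₂ ignoredT | inj₂ ignoredTs = inj₂ λ agree → cong₂ _∷_ (ignoredT agree) (ignoredTs agree)

num-occurs-or-ignoredF : ∀ {n m k} {σ : Fin (suc n) → Term m} → σ fz ≡ num k →
                         {A : Fm (suc n)} → QF A → k < ⌜ subF σ A ⌝ ⊎ IgnoresZero A
num-occurs-or-ignoredF {σ = σ} σ₀ (qf-≐ {s} {t})
  with num-occurs-or-ignoredT σ₀ s | num-occurs-or-ignoredT σ₀ t
... | inj₁ k< | _       = inj₁ (<-trans (<-trans k< (<pairˡ _ ⌜ subT σ t ⌝t)) (<pairʳ 0 _))
... | inj₂ _  | inj₁ k< = inj₁ (<-trans (<-trans k< (<pairʳ ⌜ subT σ s ⌝t _)) (<pairʳ 0 _))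
... | inj₂ ignoredS | inj₂ ignoredT = inj₂ λ agree s≡t → trans (sym (ignoredS agree)) (trans s≡t (ignoredT agree))
num-occurs-or-ignoredF σ₀ qf-⊥ = inj₂ λ _ ()
num-occurs-or-ignoredF {σ = σ} σ₀ (qf-⇒ {A} {B} qA qB)
  with num-occurs-or-ignoredF σ₀ qA | num-occurs-or-ignoredF σ₀ qB
... | inj₁ k< | _       = inj₁ (<-trans (<-trans k< (<pairˡ _ ⌜ subF σ B ⌝)) (<pairʳ 2 _))
... | inj₂ _  | inj₁ k< = inj₁ (<-trans (<-trans k< (<pairʳ ⌜ subF σ A ⌝ _)) (<pairʳ 2 _))
... | inj₂ ignoredA | inj₂ ignoredB = inj₂ λ agree A⇒B a → ignoredB agree (A⇒B (ignoredA (λ i → sym (agree i)) a))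

num-occurs-or-ignored-inst2 : ∀ {A : Fm 2} → QF A → ∀ a k → k < ⌜ inst2 A a (num k) ⌝ ⊎ IgnoresZero A
num-occurs-or-ignored-inst2 qA a k = num-occurs-or-ignoredF refl qA

Θ-instance-true : ∀ {Ax} → OneConsistent Ax → {H : Fm 2} → QF H → Ax ⊢ Θ H →
                  ∀ x → ¬ (∀ y → ¬ ⟦ H ⟧ (env2 x y))
Θ-instance-true oc {H} qH ⊢Θ x no-witness =
  oc _ (QF-subF _ qH) (mp (q1 (∃' H) (num x)) ⊢Θ) λ y Hxy →
    no-witness y (to (sem-subF qH _ λ { fz → refl ; (fs fz) → sem-renT-num fs x _ }) Hxy)

witness-descent : ∀ {Ax} → QFComplete Ax → OneConsistent Ax → {H : Fm 2} → QF H → Expresses Ax H →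
                  (⊢Θ : Ax ⊢ Θ H) → Descent _<_ (λ y → ⟦ H ⟧ (env2 ⌜ ⊢Θ ⌝p y))
witness-descent qfc oc {H} qH expr ⊢Θ {y} Hxy with to (expr ⌜ ⊢Θ ⌝p y) Hxy H qH ⊢Θ refl
... | n , ⊢Hxn , refl with num-occurs-or-ignored-inst2 qH (num ⌜ ⊢Θ ⌝p) n
...   | inj₁ n<⌜Hxn⌝ = n , <-trans n<⌜Hxn⌝ (⌜⌝<⌜⌝p ⊢Hxn) ,
                       true-inst2 qH _ n (provable-QF⇒true qfc oc (QF-subF _ qH) ⊢Hxn)
...   | inj₂ ignored = 0 , ≤-<-trans z≤n (⌜⌝<⌜⌝p ⊢Hxn) , ignored (λ { fz → refl }) Hxy

-- The defining equations and the primitive recursiveness of the axioms only matter for H to exist.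
mainTheorem1 : (Ax : Axioms) → IncludesDefEqs Ax → AxiomsPR Ax → QFComplete Ax →
               (H : Fm 2) → QF H → Expresses Ax H →
               OneConsistent Ax → ¬ (Ax ⊢ Θ H)
mainTheorem1 _ _ _ qfc _ qH expr oc ⊢Θ =
  Θ-instance-true oc qH ⊢Θ ⌜ ⊢Θ ⌝p
    (descent∧wf⇒empty (witness-descent qfc oc qH expr ⊢Θ) <-wellFounded)
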